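{- Let $r\ge3$ be an integer and let $\ell\ge2^r+1$ be an odd integer. There exists $m_0=m_0(r,\ell)$ such that for all $m\ge m_0$, the graph $H_{m,r}$ is $(C_\ell,r)$-Ramsey.
   Context: $H_{m,r}$ is the graph on disjoint vertex sets $V_1,\dots,V_{2^r+1}$, each of size $m$, containing a perfect matching between $V_{2i-1}$ and $V_{2i}$ for each $1\le i\le 2^{r-1}$, all possible edges between $V_i$ and $V_j$ for every other pair of distinct indices, and no edges inside any $V_i$. A graph is $(H,r)$-Ramsey if every colouring of its edges with $r$ colours contains a monochromatic copy of $H$. $C_\ell$ is the cycle of length $\ell$. -}

module Defs where

open import Data.Nat using (ℕ; zero; suc; _+_; _*_; _^_; _<_; _≤_; _≥_; _∸_; _/_)
open import Data.Fin using (Fin; toℕ)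
open import Data.Product using (Σ; _×_; _,_; ∃)
open import Data.Sum using (_⊎_)
open import Data.Empty using (⊥)
open import Relation.Nullary using (¬_)
open import Relation.Binary.PropositionalEquality using (_≡_; _≢_)
open import Function.Definitions using (Injective)

record Graph (V : Set) : Set₁ where
  field
    Adj    : V → V → Set
    sym    : ∀ {u v} → Adj u v → Adj v u
    irrefl : ∀ {u} → ¬ Adj u u
open Graph public

-- The parts are indexed 0-based: part i (0 ≤ i ≤ 2^r) corresponds to V_{i+1}.
-- V_{2k-1}, V_{2k} (1 ≤ k ≤ 2^{r-1}) become 0-based parts 2(k-1), 2(k-1)+1,
-- i.e. the pairs {i, j} with i ≠ j, i,j < 2^r, and ⌊i/2⌋ = ⌊j/2⌋.
MatchedPair : (r : ℕ) → ℕ → ℕ → Set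
MatchedPair r i j = i ≢ j × i < 2 ^ r × j < 2 ^ r × i / 2 ≡ j / 2

-- Adjacency of H_{m,r} on vertex set Fin (2^r + 1) × Fin m
-- (vertex (i , a) is the a-th vertex of part V_{i+1}).
-- Within matched pairs of parts: the perfect matching a ↔ a.
-- Between other distinct parts: all edges.
HAdj : (m r : ℕ) → Fin (2 ^ r + 1) × Fin m → Fin (2 ^ r + 1) × Fin m → Set
HAdj m r (i , a) (j , b) =
  toℕ i ≢ toℕ j × (MatchedPair r (toℕ i) (toℕ j) → a ≡ b)


record Colouring {V : Set} (G : Graph V) (r : ℕ) : Set where
  field
    col    : (u v : V) → Adj G u v → Fin r
    col-sym : ∀ {u v} (e : Adj G u v) → col v u (Graph.sym G e) ≡ col u v e
open Colouring public

CycNext : (ℓ : ℕ) → Fin ℓ → Fin ℓ → Set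
CycNext ℓ i j = toℕ j ≡ suc (toℕ i) ⊎ (suc (toℕ i) ≡ ℓ × toℕ j ≡ 0)

MonoCycle : {V : Set} (G : Graph V) {r : ℕ} (c : Colouring G r) (ℓ : ℕ) → Set
MonoCycle {V} G {r} c ℓ =
  Σ (Fin r) λ k → Σ (Fin ℓ → V) λ f → Injective _≡_ _≡_ f ×
    ((i j : Fin ℓ) → CycNext ℓ i j →
       Σ (Adj G (f i) (f j)) λ e → col c (f i) (f j) e ≡ k)

CycleRamsey : {V : Set} (G : Graph V) (ℓ r : ℕ) → Set
CycleRamsey G ℓ r = (c : Colouring G r) → MonoCycle G c ℓ

private
  ≢-sym : {x y : ℕ} → x ≢ y → y ≢ x
  ≢-sym p q = p (Relation.Binary.PropositionalEquality.sym q)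
    where import Relation.Binary.PropositionalEquality

  mp-sym : ∀ r {i j} → MatchedPair r j i → MatchedPair r i j
  mp-sym r (p , q , s , t) = ≢-sym p , s , q , Relation.Binary.PropositionalEquality.sym t
    where import Relation.Binary.PropositionalEquality

HAdj-sym : ∀ {m} r {u v} → HAdj m r u v → HAdj m r v u
HAdj-sym r (p , q) = ≢-sym p , λ mp → Relation.Binary.PropositionalEquality.sym (q (mp-sym r mp))
  where import Relation.Binary.PropositionalEquality

HAdj-irrefl : ∀ {m} r {u} → ¬ HAdj m r u u
HAdj-irrefl r (p , _) = p Relation.Binary.PropositionalEquality.refl
  where import Relation.Binary.PropositionalEquality

H : (m r : ℕ) → Graph (Fin (2 ^ r + 1) × Fin m)
H m r = record { Adj = HAdj m r ; sym = HAdj-sym r ; irrefl = HAdj-irrefl r }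

-- Fix an r-colouring of H_{m,r} with m large. A Ramsey argument (greedily choose vertex indices whose
-- colours towards all later ones are determined, then pigeonhole on those colour vectors) yields
-- N ℓ indices, in order, on which the colour of the edge between index u of part i and index v of
-- part j depends only on i, j and whether u < v or u = v; here N = 2^r + 1. Grouping these indices
-- into blocks of ℓ, one block per pair of matched parts, defines a colouring ρ of the complete graph
-- on the N parts: ρ(i, j) is the colour of every edge of H between the blocks of i and j (along the
-- matching if i and j are matched). A graph without odd cycles has an independent set on half of
-- any vertex set, so halving r times shows that some colour class of ρ contains an odd cycle, of
-- length T ≤ N ≤ ℓ. Matched pairs form a matching, so the cycle can be rotated to start with an
-- unmatched edge; walking back and forth along that edge (ℓ - T)/2 times, with a fresh index of the
-- block at every step, lifts it to a monochromatic cycle of length ℓ in H.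

module Submission where

open import Defs hiding (sym)
import Data.Nat.Properties
open import Algebra.Properties.CommutativeMonoid.Sum Data.Nat.Properties.+-0-commutativeMonoid
  using (sum; sum-cong-≗; ∑-distrib-+; sum-replicate-zero)
open import Algebra.Properties.CommutativeSemigroup Data.Nat.Properties.+-commutativeSemigroup
  using (x∙yz≈y∙xz)
open import Data.Bool using (Bool; true; false; _∧_; _∨_; not; if_then_else_; T)
open import Data.Fin using (Fin; zero; suc; toℕ; fromℕ<; inject≤; combine; cast)
open import Data.Fin.Properties
  using (_≟_; any?; toℕ<n; toℕ-injective; toℕ-fromℕ<; toℕ-inject≤; toℕ-cast; suc-injective; injective⇒≤;
         combine-monoˡ-<; combine-injectiveʳ)
open import Data.List using (List; []; _∷_; [_]; _++_; length; filter; lookup; allFin; cartesianProduct)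
open import Data.List.Properties using (length-tabulate)
open import Data.List.Membership.Propositional using (_∈_)
open import Data.List.Membership.Propositional.Properties using (∈-lookup; ∈-allFin; ∈-cartesianProduct⁺)
import Data.List.Membership.DecPropositional as DecMembership
open import Data.List.Relation.Binary.Sublist.Propositional using (_⊆_; []; _∷_; _∷ʳ_; ⊆-refl; ⊆-trans)
open import Data.List.Relation.Binary.Sublist.Propositional.Properties using (filter-⊆; All-resp-⊆; Any-resp-⊆)
open import Data.List.Relation.Unary.All as All using (All; []; _∷_)
open import Data.List.Relation.Unary.All.Properties using (all-filter; ¬Any⇒All¬)
open import Data.List.Relation.Unary.AllPairs using (AllPairs; []; _∷_)
open import Data.List.Relation.Unary.Any using (here; there)
open import Data.List.Relation.Unary.Unique.Propositional using (Unique)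
open import Data.List.Relation.Unary.Unique.Propositional.Properties using (allFin⁺; ++⁺)
open import Data.Nat
  using (ℕ; zero; suc; pred; _+_; _*_; _∸_; _^_; _/_; _%_; _≤_; _<_; _≥_; z≤n; s≤s; _≤?_; _<?_; parity)
open import Data.Nat.DivMod using (m≡m%n+[m/n]*n; m%n<n; m*n/n≡m; m/n≤m; /-monoˡ-≤; m<n*o⇒m/o<n)
open import Data.Nat.Divisibility using (_∤_; divides)
open Data.Nat.Properties
  using (≤-refl; ≤-reflexive; ≤-trans; ≤-antisym; ≤-pred; ≤-<-trans; <-cmp; <⇒≤; <⇒≢; <⇒≱; <⇒≯; ≰⇒>; ≮⇒≥;
         ≤∧≢⇒<; n≮0; 1+n≰n; m<n⇒m<1+n; m≤m+n; m≤n+m; m<n+m; m≤n*m;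
         +-identityʳ; +-comm; +-assoc; *-comm; *-assoc; *-suc; *-distribˡ-+;
         +-mono-≤; +-mono-<; +-monoˡ-≤; +-monoʳ-≤; *-monoʳ-≤;
         ∸-monoˡ-<; ∸-cancelʳ-≡; +-∸-assoc; m+n∸n≡m; m+[n∸m]≡n; m>n⇒m∸n≢0; module ≤-Reasoning)
  renaming (_≟_ to _≟ℕ_)
open import Data.Parity.Base using (Parity; 0ℙ; 1ℙ; _⁻¹) renaming (_+_ to _⊕_)
open import Data.Parity.Properties
  using (suc-homo-⁻¹; ⁻¹-selfInverse; +-homo-+; p+p⁻¹≡1ℙ; +-cancelˡ-≡)
  renaming (_≟_ to _≟ᵖ_; +-identityʳ to ⊕-identityʳ)
open import Data.Product using (Σ; ∃; ∃₂; _×_; _,_; proj₁; proj₂)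
open import Data.Sum using (_⊎_; inj₁; inj₂)
open import Function using (_∘_)
open import Function.Definitions using (Injective)
open import Relation.Binary.Definitions using (DecidableEquality; tri<; tri≈; tri>)
open import Relation.Binary.PropositionalEquality
  using (_≡_; _≢_; refl; cong; cong₂; sym; trans; subst; subst₂; module ≡-Reasoning)
open import Relation.Nullary using (¬_; Dec; yes; no; does; contradiction; ¬?)
open import Relation.Nullary.Decidable
  using (T?; map′; _×-dec_; _→-dec_; ¬¬-excluded-middle)

-- Pigeonhole and canonical sequences

indicator : ∀ {n} → Fin n → Fin n → ℕ
indicator a c = if does (a ≟ c) then 1 else 0

sum-indicator : ∀ {n} (a : Fin n) → sum (indicator a) ≡ 1
sum-indicator {suc n} zero    = cong suc (sum-replicate-zero n)
sum-indicator {suc n} (suc a) = sum-indicator a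

pigeonhole-sum : ∀ n (f : Fin (suc n) → ℕ) {k} → suc n * k ≤ sum f → ∃ λ c → k ≤ f c
pigeonhole-sum zero f {k} h = zero , subst₂ _≤_ (+-identityʳ k) (+-identityʳ (f zero)) h
pigeonhole-sum (suc n) f {k} h with k ≤? f zero
... | yes k≤f₀ = zero , k≤f₀
... | no k≰f₀ with pigeonhole-sum n (f ∘ suc) (≮⇒≥ λ lt → <⇒≱ (+-mono-< (≰⇒> k≰f₀) lt) h)
...   | c , k≤fc = suc c , k≤fc

module _ {A : Set} where

  colourClass : ∀ {n} → (A → Fin n) → Fin n → List A → List A
  colourClass φ c = filter (λ x → φ x ≟ c)

  length-colourClass-∷ : ∀ {n} (φ : A → Fin n) c x xs →
    length (colourClass φ c (x ∷ xs)) ≡ indicator (φ x) c + length (colourClass φ c xs)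
  length-colourClass-∷ φ c x xs with does (φ x ≟ c)
  ... | true  = refl
  ... | false = refl

  sum-length-colourClass : ∀ {n} (φ : A → Fin n) xs → sum (λ c → length (colourClass φ c xs)) ≡ length xs
  sum-length-colourClass {n} φ [] = sum-replicate-zero n
  sum-length-colourClass φ (x ∷ xs) = begin
    sum (λ c → length (colourClass φ c (x ∷ xs)))
      ≡⟨ sum-cong-≗ (λ c → length-colourClass-∷ φ c x xs) ⟩
    sum (λ c → indicator (φ x) c + length (colourClass φ c xs))
      ≡⟨ ∑-distrib-+ (indicator (φ x)) (λ c → length (colourClass φ c xs)) ⟩
    sum (indicator (φ x)) + sum (λ c → length (colourClass φ c xs))
      ≡⟨ cong₂ _+_ (sum-indicator (φ x)) (sum-length-colourClass φ xs) ⟩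
    suc (length xs) ∎
    where open ≡-Reasoning

  pigeonhole : ∀ {n} (φ : A → Fin (suc n)) xs {k} → suc n * k ≤ length xs →
    ∃ λ c → k ≤ length (colourClass φ c xs)
  pigeonhole {n} φ xs h = pigeonhole-sum n _ (subst (_ ≤_) (sym (sum-length-colourClass φ xs)) h)

  Monochromatic : ∀ {n} → (A → Fin n) → List A → Set
  Monochromatic φ ys = ∃ λ c → All (λ y → φ y ≡ c) ys

  monochromaticSublist : ∀ {I : Set} {n} (is : List I) (φ : I → A → Fin (suc n)) xs {k} →
    suc n ^ length is * k ≤ length xs →
    ∃ λ ys → ys ⊆ xs × k ≤ length ys × All (λ i → Monochromatic (φ i) ys) is
  monochromaticSublist [] φ xs {k} h = xs , ⊆-refl , subst (_≤ length xs) (+-identityʳ k) h , []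
  monochromaticSublist {n = n} (i ∷ is) φ xs {k} h
    with c , large ← pigeonhole (φ i) xs (subst (_≤ length xs) (*-assoc (suc n) (suc n ^ length is) k) h)
    with ys , ys⊆ , k≤ , mono ← monochromaticSublist is φ (colourClass (φ i) c xs) large
    = ys , ⊆-trans ys⊆ (filter-⊆ _ xs) , k≤ , (c , All-resp-⊆ ys⊆ (all-filter _ xs)) ∷ mono

  AllPairs-resp-⊇ : ∀ {R : A → A → Set} {xs ys} → xs ⊆ ys → AllPairs R ys → AllPairs R xs
  AllPairs-resp-⊇ [] [] = []
  AllPairs-resp-⊇ (y ∷ʳ τ) (_ ∷ rys) = AllPairs-resp-⊇ τ rys
  AllPairs-resp-⊇ (refl ∷ τ) (ry ∷ rys) = All-resp-⊆ τ ry ∷ AllPairs-resp-⊇ τ rys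

  lookup-AllPairs : ∀ {R : A → A → Set} {xs} → AllPairs R xs →
    ∀ {i j} → toℕ i < toℕ j → R (lookup xs i) (lookup xs j)
  lookup-AllPairs (rx ∷ _)  {zero}  {suc j} _         = All.lookup rx (∈-lookup j)
  lookup-AllPairs (_ ∷ rxs) {suc i} {suc j} (s≤s i<j) = lookup-AllPairs rxs i<j

greedyBound : ℕ → ℕ → ℕ
greedyBound K zero    = 0
greedyBound K (suc L) = suc (K * greedyBound K L)

canonicalBound : ℕ → ℕ → ℕ
canonicalBound K L = greedyBound K (K * (K * L))

module _ {A I : Set} {n : ℕ} (F : A → A → I → Fin (suc n)) (is : List I) (complete : ∀ i → i ∈ is) where

  private
    K : ℕ
    K = suc n ^ length is

    common : ∀ {B : Set} {φ : I → B → Fin (suc n)} {ys} →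
      All (λ i → Monochromatic (φ i) ys) is → I → Fin (suc n)
    common mono i = proj₁ (All.lookup mono (complete i))

    common-spec : ∀ {B : Set} {φ : I → B → Fin (suc n)} {ys y} (mono : All (λ i → Monochromatic (φ i) ys) is) →
      y ∈ ys → ∀ i → φ i y ≡ common mono i
    common-spec mono y∈ i = All.lookup (proj₂ (All.lookup mono (complete i))) y∈

  EndHomogeneous : A × (I → Fin (suc n)) → A × (I → Fin (suc n)) → Set
  EndHomogeneous (x , colours) (y , _) = x ≢ y × (∀ i → F x y i ≡ colours i)

  endHomogeneousSequence : ∀ L xs → Unique xs → greedyBound K L ≤ length xs →
    ∃ λ zs → length zs ≡ L × AllPairs EndHomogeneous zs × All (λ z → proj₁ z ∈ xs) zs
  endHomogeneousSequence zero xs _ _ = [] , refl , [] , []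
  endHomogeneousSequence (suc L) (x ∷ xs) (x∉xs ∷ uxs) (s≤s h)
    with ys , ys⊆ , large , mono ← monochromaticSublist is (λ i y → F x y i) xs h
    with zs , refl , homog , zs∈ ← endHomogeneousSequence L ys (AllPairs-resp-⊇ ys⊆ uxs) large
    = (x , common mono) ∷ zs , refl , All.map x-related zs∈ ∷ homog ,
      here refl ∷ All.map (there ∘ Any-resp-⊆ ys⊆) zs∈
    where
    x-related : ∀ {y} → y ∈ ys → x ≢ y × (∀ i → F x y i ≡ common mono i)
    x-related y∈ = All.lookup x∉xs (Any-resp-⊆ ys⊆ y∈) , common-spec mono y∈

  record CanonicalSequence (L : ℕ) : Set where
    field
      seq           : Fin L → A
      seq-injective : Injective _≡_ _≡_ seq
      offDiagonal   : I → Fin (suc n)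
      diagonal      : I → Fin (suc n)
      colour-<      : ∀ {u v} → toℕ u < toℕ v → ∀ i → F (seq u) (seq v) i ≡ offDiagonal i
      colour-≡      : ∀ u i → F (seq u) (seq u) i ≡ diagonal i

  canonicalSequence : ∀ L xs → Unique xs → canonicalBound (suc n ^ length is) L ≤ length xs →
    CanonicalSequence L
  canonicalSequence L xs uxs h
    with zs , len-zs , homog , _ ← endHomogeneousSequence (K * (K * L)) xs uxs h
    with ys , ys⊆ , large , monoOff ← monochromaticSublist is (λ i z → proj₂ z i) zs (≤-reflexive (sym len-zs))
    with ws , ws⊆ , L≤ , monoDiag ← monochromaticSublist is (λ i w → F (proj₁ w) (proj₁ w) i) ys large
    = record
      { seq           = seq
      ; seq-injective = injective
      ; offDiagonal   = common monoOff
      ; diagonal      = common monoDiag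
      ; colour-<      = λ {u} u<v i →
          trans (proj₂ (related u<v) i) (common-spec monoOff (Any-resp-⊆ ws⊆ (∈-lookup (position u))) i)
      ; colour-≡      = λ u → common-spec monoDiag (∈-lookup (position u))
      }
    where
    homog-ws : AllPairs EndHomogeneous ws
    homog-ws = AllPairs-resp-⊇ (⊆-trans ws⊆ ys⊆) homog
    position : Fin L → Fin (length ws)
    position u = inject≤ u L≤
    seq : Fin L → A
    seq u = proj₁ (lookup ws (position u))
    related : ∀ {u v} → toℕ u < toℕ v → EndHomogeneous (lookup ws (position u)) (lookup ws (position v))
    related {u} {v} u<v =
      lookup-AllPairs homog-ws (subst₂ _<_ (sym (toℕ-inject≤ u L≤)) (sym (toℕ-inject≤ v L≤)) u<v)
    injective : Injective _≡_ _≡_ seq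
    injective {u} {v} eq with <-cmp (toℕ u) (toℕ v)
    ... | tri< u<v _ _ = contradiction eq (proj₁ (related u<v))
    ... | tri≈ _ u≡v _ = toℕ-injective u≡v
    ... | tri> _ _ v<u = contradiction (sym eq) (proj₁ (related v<u))

-- Independent sets in graphs without odd closed walks

¬¬-decidable-Fin : ∀ {N} (P : Fin N → Set) → ¬ ¬ (∀ x → Dec (P x))
¬¬-decidable-Fin {zero}  P k = k λ ()
¬¬-decidable-Fin {suc N} P k =
  ¬¬-excluded-middle λ P₀? → ¬¬-decidable-Fin (P ∘ suc) λ P? → k λ { zero → P₀? ; (suc x) → P? x }

T-∨⁻ : ∀ a {b} → T (a ∨ b) → T a ⊎ T b
T-∨⁻ true  t = inj₁ t
T-∨⁻ false t = inj₂ t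

m+n≤2*o : ∀ {a b c} → a ≤ c → b ≤ c → a + b ≤ 2 * c
m+n≤2*o {a} {b} {c} a≤c b≤c = subst (a + b ≤_) (cong (c +_) (sym (+-identityʳ c))) (+-mono-≤ a≤c b≤c)

∧-snd : ∀ {a b} → T (a ∧ b) → T b
∧-snd {true} t = t

size : ∀ {N} → (Fin N → Bool) → ℕ
size S = sum λ x → if S x then 1 else 0

size-split : ∀ {N} (S P : Fin N → Bool) → size S ≡ size (λ x → P x ∧ S x) + size (λ x → not (P x) ∧ S x)
size-split {N} S P = trans (sum-cong-≗ {N} pointwise) (∑-distrib-+ {N} _ _)
  where
  pointwise : ∀ x → (if S x then 1 else 0) ≡ (if P x ∧ S x then 1 else 0) + (if not (P x) ∧ S x then 1 else 0)
  pointwise x with P x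
  ... | true  = sym (+-identityʳ _)
  ... | false = refl

size-∨ : ∀ {N} (X Z : Fin N → Bool) → (∀ {x} → T (X x) → ¬ T (Z x)) →
  size (λ x → X x ∨ Z x) ≡ size X + size Z
size-∨ {N} X Z disjoint = trans (sum-cong-≗ {N} pointwise) (∑-distrib-+ {N} _ _)
  where
  pointwise : ∀ x → (if X x ∨ Z x then 1 else 0) ≡ (if X x then 1 else 0) + (if Z x then 1 else 0)
  pointwise x with X x | Z x | disjoint {x}
  ... | true  | true  | disj = contradiction _ (disj _)
  ... | true  | false | _    = refl
  ... | false | _     | _    = refl

size-full : ∀ N → size {N} (λ _ → true) ≡ N
size-full zero    = refl
size-full (suc N) = cong suc (size-full N)

size-pos : ∀ {N} (S : Fin N → Bool) x → T (S x) → 1 ≤ size S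
size-pos S zero    Sx with S zero
... | true = s≤s z≤n
size-pos S (suc x) Sx = ≤-trans (size-pos (S ∘ suc) x Sx) (m≤n+m _ _)

element : ∀ {N} (S : Fin N → Bool) → 1 ≤ size S → ∃ λ x → T (S x)
element {suc N} S h with S zero in S₀
... | true  = zero , subst T (sym S₀) _
... | false = let x , Sx = element (S ∘ suc) h in suc x , Sx

two-elements : ∀ {N} (S : Fin N → Bool) → 2 ≤ size S → ∃₂ λ x y → T (S x) × T (S y) × x ≢ y
two-elements {suc N} S h with S zero in S₀
... | true  = let y , Sy = element (S ∘ suc) (≤-pred h) in zero , suc y , subst T (sym S₀) _ , Sy , λ ()
... | false = let x , y , Sx , Sy , x≢y = two-elements (S ∘ suc) h in
              suc x , suc y , Sx , Sy , x≢y ∘ suc-injective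

data Walk {V : Set} (E : V → V → Set) : V → V → ℕ → Set where
  []  : ∀ {u} → Walk E u u 0
  _∷_ : ∀ {u v w n} → E u v → Walk E v w n → Walk E u w (suc n)

module _ {V : Set} {E : V → V → Set} where

  infixr 5 _++ᵂ_

  _++ᵂ_ : ∀ {u v w a b} → Walk E u v a → Walk E v w b → Walk E u w (a + b)
  []      ++ᵂ W = W
  (e ∷ V) ++ᵂ W = e ∷ (V ++ᵂ W)

  snoc : ∀ {u v w n} → Walk E u v n → E v w → Walk E u w (suc n)
  snoc []      e = e ∷ []
  snoc (e′ ∷ W) e = e′ ∷ snoc W e

  reverse : (∀ {x y} → E x y → E y x) → ∀ {u v n} → Walk E u v n → Walk E v u n
  reverse E-sym []      = []
  reverse E-sym (e ∷ W) = snoc (reverse E-sym W) (E-sym e)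

OddClosedWalk : {V : Set} → (V → V → Set) → Set
OddClosedWalk E = ∃₂ λ u n → parity n ≡ 1ℙ × Walk E u u n

parity-suc : ∀ n → parity (suc n) ≡ parity n ⁻¹
parity-suc n = sym (⁻¹-selfInverse (suc-homo-⁻¹ n))

parity-+-suc : ∀ a b → parity a ≡ parity b → parity (a + suc b) ≡ 1ℙ
parity-+-suc a b eq = begin
  parity (a + suc b)         ≡⟨ +-homo-+ a (suc b) ⟩
  parity a ⊕ parity (suc b)  ≡⟨ cong₂ _⊕_ eq (parity-suc b) ⟩
  parity b ⊕ parity b ⁻¹     ≡⟨ p+p⁻¹≡1ℙ (parity b) ⟩
  1ℙ                         ∎
  where open ≡-Reasoning

module _ {N : ℕ} (E : Fin N → Fin N → Set) where

  Independent : (Fin N → Bool) → Set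
  Independent S = ∀ {x y} → T (S x) → T (S y) → ¬ E x y

  LargeIndependentSubset : (Fin N → Bool) → Set
  LargeIndependentSubset S =
    ∃ λ S′ → (∀ {x} → T (S′ x) → T (S x)) × Independent S′ × size S ≤ 2 * size S′

module Halving {N : ℕ} {E : Fin N → Fin N → Set} (E-sym : ∀ {x y} → E x y → E y x)
               (noOdd : ¬ OddClosedWalk E) where

  Reach : Parity → Fin N → Fin N → Set
  Reach p v x = ∃ λ n → parity n ≡ p × Walk E v x n

  reach-step : ∀ {p v x y} → Reach p v x → E x y → Reach (p ⁻¹) v y
  reach-step (n , refl , W) e = suc n , parity-suc n , snoc W e

  reach-independent : ∀ {p v x y} → Reach p v x → Reach p v y → ¬ E x y
  reach-independent (a , refl , Wx) (b , pb , Wy) e =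
    noOdd (_ , a + suc b , parity-+-suc a b (sym pb) , Wx ++ᵂ e ∷ reverse E-sym Wy)

  module Split (S : Fin N → Bool) (v : Fin N)
               (even? : ∀ x → Dec (Reach 0ℙ v x)) (odd? : ∀ x → Dec (Reach 1ℙ v x)) where

    Sᵉ Sᵒ S⁰ : Fin N → Bool
    Sᵉ x = does (even? x) ∧ S x
    Sᵒ x = does (odd? x) ∧ (not (does (even? x)) ∧ S x)
    S⁰ x = not (does (odd? x)) ∧ (not (does (even? x)) ∧ S x)

    size-S : size S ≡ size Sᵉ + (size Sᵒ + size S⁰)
    size-S = trans (size-split S (does ∘ even?)) (cong (size Sᵉ +_) (size-split _ (does ∘ odd?)))

    Sᵉ-reached : ∀ {x} → T (Sᵉ x) → Reach 0ℙ v x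
    Sᵉ-reached {x} x∈ with even? x
    ... | yes r = r

    Sᵒ-reached : ∀ {x} → T (Sᵒ x) → Reach 1ℙ v x
    Sᵒ-reached {x} x∈ with odd? x
    ... | yes r = r

    S⁰-unreached : ∀ {p x} → T (S⁰ x) → ¬ Reach p v x
    S⁰-unreached {p} {x} x∈ with odd? x | even? x
    S⁰-unreached {0ℙ} x∈ | no _ | no ¬r = ¬r
    S⁰-unreached {1ℙ} x∈ | no ¬r | no _ = ¬r

    Sᵒ-⊆ : ∀ {x} → T (Sᵒ x) → T (S x)
    Sᵒ-⊆ {x} x∈ with odd? x | even? x
    ... | yes _ | no _ = x∈

    S⁰-⊆ : ∀ {x} → T (S⁰ x) → T (S x)
    S⁰-⊆ {x} x∈ with odd? x | even? x
    ... | no _ | no _ = x∈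

    S⁰-isolated : ∀ {p x y} → Reach p v x → T (S⁰ y) → ¬ E x y
    S⁰-isolated r y∈ e = S⁰-unreached y∈ (reach-step r e)

    size-S⁰< : T (S v) → size S⁰ < size S
    size-S⁰< v∈S = begin-strict
      size S⁰                            <⟨ +-mono-≤ (size-pos Sᵉ v v∈Sᵉ) (m≤n+m (size S⁰) (size Sᵒ)) ⟩
      size Sᵉ + (size Sᵒ + size S⁰)     ≡⟨ sym size-S ⟩
      size S                             ∎
      where
      open ≤-Reasoning
      v∈Sᵉ : T (Sᵉ v)
      v∈Sᵉ with even? v
      ... | yes _ = v∈S
      ... | no ¬r = contradiction (0 , refl , []) ¬r

    ReachedIndependent : Set
    ReachedIndependent = ∃ λ X → (∀ {x} → T (X x) → T (S x)) × (∀ {x} → T (X x) → ∃ λ p → Reach p v x) ×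
                    Independent E X × size Sᵉ + size Sᵒ ≤ 2 * size X

    larger : ReachedIndependent
    larger with size Sᵒ ≤? size Sᵉ
    ... | yes o≤e = Sᵉ , ∧-snd , (λ x∈ → 0ℙ , Sᵉ-reached x∈) ,
                    (λ x∈ y∈ → reach-independent (Sᵉ-reached x∈) (Sᵉ-reached y∈)) , m+n≤2*o ≤-refl o≤e
    ... | no o≰e = Sᵒ , Sᵒ-⊆ , (λ x∈ → 1ℙ , Sᵒ-reached x∈) ,
                    (λ x∈ y∈ → reach-independent (Sᵒ-reached x∈) (Sᵒ-reached y∈)) ,
                    m+n≤2*o (<⇒≤ (≰⇒> o≰e)) ≤-refl

    merge : ReachedIndependent → LargeIndependentSubset E S⁰ → LargeIndependentSubset E S
    merge (X , X⊆ , X-reached , X-ind , X-large) (Z , Z⊆ , Z-ind , Z-large) =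
      (λ x → X x ∨ Z x) , ⊆S , independent , large
      where
      disjoint : ∀ {x} → T (X x) → ¬ T (Z x)
      disjoint x∈ z∈ = S⁰-unreached (Z⊆ z∈) (proj₂ (X-reached x∈))
      ⊆S : ∀ {x} → T (X x ∨ Z x) → T (S x)
      ⊆S {x} x∈ with T-∨⁻ (X x) x∈
      ... | inj₁ x∈X = X⊆ x∈X
      ... | inj₂ x∈Z = S⁰-⊆ (Z⊆ x∈Z)
      independent : Independent E (λ x → X x ∨ Z x)
      independent {x} {y} x∈ y∈ with T-∨⁻ (X x) x∈ | T-∨⁻ (X y) y∈
      ... | inj₁ x∈X | inj₁ y∈X = X-ind x∈X y∈X
      ... | inj₁ x∈X | inj₂ y∈Z = S⁰-isolated (proj₂ (X-reached x∈X)) (Z⊆ y∈Z)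
      ... | inj₂ x∈Z | inj₁ y∈X = S⁰-isolated (proj₂ (X-reached y∈X)) (Z⊆ x∈Z) ∘ E-sym
      ... | inj₂ x∈Z | inj₂ y∈Z = Z-ind x∈Z y∈Z
      large : size S ≤ 2 * size (λ x → X x ∨ Z x)
      large = begin
        size S                                   ≡⟨ trans size-S (sym (+-assoc (size Sᵉ) _ _)) ⟩
        size Sᵉ + size Sᵒ + size S⁰             ≤⟨ +-mono-≤ X-large Z-large ⟩
        2 * size X + 2 * size Z                 ≡⟨ sym (*-distribˡ-+ 2 (size X) (size Z)) ⟩
        2 * (size X + size Z)                   ≡⟨ cong (2 *_) (sym (size-∨ X Z disjoint)) ⟩
        2 * size (λ x → X x ∨ Z x)              ∎
        where open ≤-Reasoning

  -- Reachability by even and by odd walks from v is decided only under double negation.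
  halving : ∀ B S → size S ≤ B → ¬ ¬ LargeIndependentSubset E S
  halving B S S≤B k with any? (λ x → T? (S x))
  ... | no empty = k (S , (λ x∈ → x∈) , (λ x∈ _ → contradiction (_ , x∈) empty) , m≤n*m (size S) 2)
  ... | yes (v , v∈) with B
  ...   | zero   = contradiction S≤B (<⇒≱ (size-pos S v v∈))
  ...   | suc B′ =
    ¬¬-decidable-Fin (Reach 0ℙ v) λ even? → ¬¬-decidable-Fin (Reach 1ℙ v) λ odd? →
      let open Split S v even? odd? in
      halving B′ S⁰ (≤-pred (≤-trans (size-S⁰< v∈) S≤B)) λ Z → k (merge larger Z)

HasColour : ∀ {N r} → (Fin N → Fin N → Fin r) → ℕ → Fin N → Fin N → Set
HasColour ρ k x y = x ≢ y × toℕ (ρ x y) ≡ k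

module _ {N r : ℕ} (ρ : Fin N → Fin N → Fin r) (ρ-sym : ∀ {x y} → x ≢ y → ρ x y ≡ ρ y x) where

  HasColour-sym : ∀ {k x y} → HasColour ρ k x y → HasColour ρ k y x
  HasColour-sym (x≢y , ρxy≡k) = x≢y ∘ sym , trans (cong toℕ (sym (ρ-sym x≢y))) ρxy≡k

  fewColours⇒small : (∀ k → ¬ OddClosedWalk (HasColour ρ k)) → ∀ k S →
    (∀ {x y} → T (S x) → T (S y) → x ≢ y → toℕ (ρ x y) < k) → ¬ 2 ^ k < size S
  fewColours⇒small noOdd zero S below large =
    let x , y , x∈ , y∈ , x≢y = two-elements S large in n≮0 (below x∈ y∈ x≢y)
  fewColours⇒small noOdd (suc k) S below large =
    Halving.halving HasColour-sym (noOdd k) (size S) S ≤-refl λ (S′ , S′⊆S , independent , half) →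
      fewColours⇒small noOdd k S′ (below′ S′⊆S independent)
        (≰⇒> λ small → <⇒≱ large (≤-trans half (*-monoʳ-≤ 2 small)))
    where
    below′ : ∀ {S′} → (∀ {x} → T (S′ x) → T (S x)) → Independent (HasColour ρ k) S′ →
      ∀ {x y} → T (S′ x) → T (S′ y) → x ≢ y → toℕ (ρ x y) < k
    below′ S′⊆S independent x∈ y∈ x≢y =
      ≤∧≢⇒< (≤-pred (below (S′⊆S x∈) (S′⊆S y∈) x≢y)) λ ρxy≡k → independent x∈ y∈ (x≢y , ρxy≡k)

  ¬¬monochromaticOddClosedWalk : 2 ^ r < N → ¬ (∀ k → ¬ OddClosedWalk (HasColour ρ k))
  ¬¬monochromaticOddClosedWalk large noOdd =
    fewColours⇒small noOdd r (λ _ → true) (λ {x} {y} _ _ _ → toℕ<n (ρ x y))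
      (subst (2 ^ r <_) (sym (size-full N)) large)

-- From odd closed walks to odd cycles

loop-shorter : ∀ a b c → 1 ≤ a + c → suc b < a + (suc b + c)
loop-shorter a b c pos = subst (suc b <_) (sym (x∙yz≈y∙xz a (suc b) c))
  (subst (_≤ suc b + (a + c)) (+-comm (suc b) 1) (+-monoʳ-≤ (suc b) pos))

ends-shorter : ∀ a b c → a + c < a + (suc b + c)
ends-shorter a b c = subst (a + c <_) (sym (x∙yz≈y∙xz a (suc b) c)) (m<n+m (a + c) {suc b} (s≤s z≤n))

parity-drop-even : ∀ a m c → parity m ≡ 0ℙ → parity (a + (m + c)) ≡ parity (a + c)
parity-drop-even a m c even = begin
  parity (a + (m + c))       ≡⟨ cong parity (x∙yz≈y∙xz a m c) ⟩
  parity (m + (a + c))       ≡⟨ +-homo-+ m (a + c) ⟩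
  parity m ⊕ parity (a + c)  ≡⟨ cong (_⊕ parity (a + c)) even ⟩
  parity (a + c)             ∎
  where open ≡-Reasoning

module _ {V : Set} {E : V → V → Set} where

  vertices : ∀ {u w n} → Walk E u w n → List V
  vertices []            = []
  vertices (_∷_ {u} _ W) = u ∷ vertices W

  length-vertices : ∀ {u w n} (W : Walk E u w n) → length (vertices W) ≡ n
  length-vertices []      = refl
  length-vertices (_ ∷ W) = cong suc (length-vertices W)

  vertices-snoc : ∀ {u v w n} (W : Walk E u v n) (e : E v w) → vertices (snoc W e) ≡ vertices W ++ [ v ]
  vertices-snoc []       e = refl
  vertices-snoc (e′ ∷ W) e = cong (_ ∷_) (vertices-snoc W e)

  splitAt∈ : ∀ {u w n x} (W : Walk E u w n) → x ∈ vertices W →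
    ∃₂ λ a c → Walk E u x a × Walk E x w (suc c) × a + suc c ≡ n
  splitAt∈ (_∷_ {n = n} e W) (here refl) = 0 , n , [] , e ∷ W , refl
  splitAt∈ (e ∷ W) (there x∈) =
    let a , c , W₁ , W₂ , eq = splitAt∈ W x∈ in suc a , c , e ∷ W₁ , W₂ , cong suc eq

  record Shortcut (u w : V) (n : ℕ) : Set where
    field
      {via}   : V
      {a b c} : ℕ
      prefix  : Walk E u via a
      loop    : Walk E via via (suc b)
      suffix  : Walk E via w c
      total   : a + (suc b + c) ≡ n
      nonempty : 1 ≤ a + c

  shorterOddClosedWalk : ∀ {u n} → Shortcut u u n → parity n ≡ 1ℙ →
    ∃₂ λ v n′ → n′ < n × parity n′ ≡ 1ℙ × Walk E v v n′
  shorterOddClosedWalk record { a = a ; b = b ; c = c ; prefix = prefix ; loop = loop ; suffix = suffix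
                              ; total = refl ; nonempty = nonempty } odd
    with parity (suc b) in loop-parity
  ... | 1ℙ = _ , _ , loop-shorter a b c nonempty , loop-parity , loop
  ... | 0ℙ = _ , _ , ends-shorter a b c , trans (sym (parity-drop-even a (suc b) c loop-parity)) odd ,
             prefix ++ᵂ suffix

  UniqueOddClosedWalk : Set
  UniqueOddClosedWalk = ∃₂ λ u n → parity n ≡ 1ℙ × Σ (Walk E u u n) (Unique ∘ vertices)

  module _ (_≟_ : DecidableEquality V) where

    open DecMembership _≟_ using (_∈?_)

    uniqueOrShortcut : ∀ {u w n} (W : Walk E u w n) → Unique (vertices W) ⊎ Shortcut u w n
    uniqueOrShortcut [] = inj₁ []
    uniqueOrShortcut (_∷_ {u} e W) with u ∈? vertices W
    ... | yes u∈ = let a , c , W₁ , W₂ , eq = splitAt∈ W u∈ in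
      inj₂ record { prefix = [] ; loop = e ∷ W₁ ; suffix = W₂ ; total = cong suc eq ; nonempty = s≤s z≤n }
    ... | no u∉ with uniqueOrShortcut W
    ...   | inj₁ unique = inj₁ (¬Any⇒All¬ _ u∉ ∷ unique)
    ...   | inj₂ s = inj₂ record
      { prefix = e ∷ prefix ; loop = loop ; suffix = suffix ; total = cong suc total ; nonempty = s≤s z≤n }
      where open Shortcut s

    shorten : ∀ fuel {u n} → n ≤ fuel → parity n ≡ 1ℙ → Walk E u u n → UniqueOddClosedWalk
    shorten zero       z≤n () _
    shorten (suc fuel) n≤  odd W with uniqueOrShortcut W
    ... | inj₁ unique = _ , _ , odd , W , unique
    ... | inj₂ s = let _ , _ , n′<n , odd′ , W′ = shorterOddClosedWalk s odd in
                   shorten fuel (≤-pred (≤-trans n′<n n≤)) odd′ W′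

  lookup-vertices-head : ∀ {u w n} (W : Walk E u w n) i → toℕ i ≡ 0 → lookup (vertices W) i ≡ u
  lookup-vertices-head (e ∷ W) zero refl = refl

  lookup-vertices-step : ∀ {u w n} (W : Walk E u w n) i j → toℕ j ≡ suc (toℕ i) →
    E (lookup (vertices W) i) (lookup (vertices W) j)
  lookup-vertices-step (e ∷ W) zero    (suc j) j≡1 =
    subst (E _) (sym (lookup-vertices-head W j (cong pred j≡1))) e
  lookup-vertices-step (e ∷ W) (suc i) (suc j) eq = lookup-vertices-step W i j (cong pred eq)

  lookup-vertices-last : ∀ {u w n} (W : Walk E u w n) i → suc (toℕ i) ≡ length (vertices W) →
    E (lookup (vertices W) i) w
  lookup-vertices-last (e ∷ [])     zero    refl = e
  lookup-vertices-last (e ∷ e′ ∷ W) (suc i) eq   = lookup-vertices-last (e′ ∷ W) i (cong pred eq)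

  lookup-vertices-cycNext : ∀ {u n} (W : Walk E u u n) i j → CycNext (length (vertices W)) i j →
    E (lookup (vertices W) i) (lookup (vertices W) j)
  lookup-vertices-cycNext W i j (inj₁ j≡1+i) = lookup-vertices-step W i j j≡1+i
  lookup-vertices-cycNext W i j (inj₂ (last , j≡0)) =
    subst (E _) (sym (lookup-vertices-head W j j≡0)) (lookup-vertices-last W i last)

lookup-injective : ∀ {A : Set} {xs : List A} → Unique xs → Injective _≡_ _≡_ (lookup xs)
lookup-injective (_ ∷ _)       {zero}  {zero}  _  = refl
lookup-injective (x∉ ∷ _)      {zero}  {suc j} eq = contradiction eq (All.lookup x∉ (∈-lookup j))
lookup-injective (x∉ ∷ _)      {suc i} {zero}  eq = contradiction (sym eq) (All.lookup x∉ (∈-lookup i))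
lookup-injective (_ ∷ unique) {suc i} {suc j} eq = cong suc (lookup-injective unique eq)

Unique-rotate : ∀ {A : Set} {x : A} {xs} → Unique (x ∷ xs) → Unique (xs ++ [ x ])
Unique-rotate (x∉ ∷ unique) = ++⁺ unique ([] ∷ []) λ { (x∈ , here refl) → All.lookup x∉ x∈ refl }

record OddCycle {V : Set} (E M : V → V → Set) : Set where
  field
    cycleLength     : ℕ
    vertex          : Fin cycleLength → V
    odd             : parity cycleLength ≡ 1ℙ
    nontrivial      : 3 ≤ cycleLength
    injective       : Injective _≡_ _≡_ vertex
    edge            : ∀ i j → CycNext cycleLength i j → E (vertex i) (vertex j)
    start-unmatched : ∀ i j → toℕ i ≡ 0 → toℕ j ≡ 1 → ¬ M (vertex i) (vertex j)

module _ {V : Set} {E M : V → V → Set} (E-irrefl : ∀ {x} → ¬ E x x) (M? : ∀ x y → Dec (M x y))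
         (M-partner : ∀ {x y z} → M x y → M y z → x ≡ z) where

  private
    fromUniqueWalk : ∀ {u v n} (e : E u v) (W : Walk E v u n) → Unique (vertices (e ∷ W)) →
      parity (suc n) ≡ 1ℙ → 3 ≤ suc n → ¬ M u v → OddCycle E M
    fromUniqueWalk e W unique odd 3≤n ¬M = record
      { cycleLength     = Data.List.length (vertices (e ∷ W))
      ; vertex          = lookup (vertices (e ∷ W))
      ; odd             = subst (λ n → parity n ≡ 1ℙ) (sym (length-vertices (e ∷ W))) odd
      ; nontrivial      = subst (3 ≤_) (sym (length-vertices (e ∷ W))) 3≤n
      ; injective       = lookup-injective unique
      ; edge            = lookup-vertices-cycNext (e ∷ W)
      ; start-unmatched = start
      }
      where
      start : ∀ i j → toℕ i ≡ 0 → toℕ j ≡ 1 → ¬ M (lookup (vertices (e ∷ W)) i) (lookup (vertices (e ∷ W)) j)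
      start zero (suc j) refl j≡1 rewrite lookup-vertices-head W j (cong pred j≡1) = ¬M

  oddCycle : UniqueOddClosedWalk {E = E} → OddCycle E M
  oddCycle (_ , 1 , _ , e ∷ [] , _) = contradiction e E-irrefl
  oddCycle (u , suc (suc (suc n)) , odd , e₁ ∷ _∷_ {v} e₂ W@(_ ∷ _) , unique@(u∉ ∷ _))
    with M? u v
  ... | no ¬M = fromUniqueWalk e₁ (e₂ ∷ W) unique odd (s≤s (s≤s (s≤s z≤n))) ¬M
  ... | yes M₁ = fromUniqueWalk e₂ (snoc W e₁)
        (subst Unique (cong (v ∷_) (sym (vertices-snoc W e₁))) (Unique-rotate unique))
        odd (s≤s (s≤s (s≤s z≤n))) (λ M₂ → All.lookup u∉ (there (here refl)) (M-partner M₁ M₂))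

walk? : ∀ {N} {E : Fin N → Fin N → Set} → (∀ x y → Dec (E x y)) → ∀ n u w → Dec (Walk E u w n)
walk? E? zero    u w = map′ (λ { refl → [] }) (λ { [] → refl }) (u ≟ w)
walk? E? (suc n) u w = map′ (λ (_ , e , W) → e ∷ W) (λ { (e ∷ W) → _ , e , W })
                            (any? λ v → E? u v ×-dec walk? E? n v w)

module _ {N r : ℕ} (ρ : Fin N → Fin N → Fin r) (ρ-sym : ∀ {x y} → x ≢ y → ρ x y ≡ ρ y x)
         {M : Fin N → Fin N → Set} (M? : ∀ x y → Dec (M x y))
         (M-partner : ∀ {x y z} → M x y → M y z → x ≡ z) where

  private
    HasColour? : ∀ k x y → Dec (HasColour ρ k x y)
    HasColour? k x y = ¬? (x ≟ y) ×-dec (toℕ (ρ x y) ≟ℕ k)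

    ShortOddClosedWalk : Fin r → Set
    ShortOddClosedWalk c =
      ∃ λ u → ∃ λ (n : Fin (suc N)) → parity (toℕ n) ≡ 1ℙ × Walk (HasColour ρ (toℕ c)) u u (toℕ n)

    shortOddClosedWalk? : Dec (∃ ShortOddClosedWalk)
    shortOddClosedWalk? = any? λ c → any? λ u → any? λ n →
      (parity (toℕ n) ≟ᵖ 1ℙ) ×-dec walk? (HasColour? (toℕ c)) (toℕ n) u u

    shortened : ∀ {k} → OddClosedWalk (HasColour ρ k) → ∃ ShortOddClosedWalk
    shortened {k} (u , n , odd , W) with shorten _≟_ n ≤-refl odd W
    ... | u′ , suc n′ , odd′ , W′@(_∷_ {v = v} e _) , unique =
      ρ u′ v , u′ , fromℕ< (s≤s n≤N) , subst (λ m → parity m ≡ 1ℙ) (sym (toℕ-fromℕ< (s≤s n≤N))) odd′ ,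
      subst (λ m → Walk (HasColour ρ (toℕ (ρ u′ v))) u′ u′ m) (sym (toℕ-fromℕ< (s≤s n≤N)))
            (subst (λ k → Walk (HasColour ρ k) u′ u′ (suc n′)) (sym (proj₂ e)) W′)
      where
      n≤N : suc n′ ≤ N
      n≤N = subst (_≤ N) (length-vertices W′) (injective⇒≤ (lookup-injective unique))

  -- Odd closed walks of length at most N can be searched for exhaustively, and shortening shows that
  -- they exist if any odd closed walk does; this recovers a witness from the double negation.
  monochromaticOddCycle : 2 ^ r < N → ∃ λ (c : Fin r) → OddCycle (HasColour ρ (toℕ c)) M
  monochromaticOddCycle large with shortOddClosedWalk?
  ... | yes (c , u , n , odd , W) =
    c , oddCycle (λ e → proj₁ e refl) M? M-partner (shorten _≟_ (toℕ n) ≤-refl odd W)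
  ... | no none =
    contradiction (λ k oddWalk → none (shortened oddWalk)) (¬¬monochromaticOddClosedWalk ρ ρ-sym large)

-- Winding a cycle around its first edge

CycNextℕ : ℕ → ℕ → ℕ → Set
CycNextℕ n a b = b ≡ suc a ⊎ (suc a ≡ n × b ≡ 0)

FirstEdge : ℕ → ℕ → Set
FirstEdge a b = (a ≡ 0 × b ≡ 1) ⊎ (a ≡ 1 × b ≡ 0)

bit : ℕ → ℕ
bit 0             = 0
bit 1             = 1
bit (suc (suc n)) = bit n

bit-even : ∀ s → bit (2 * s) ≡ 0
bit-even zero    = refl
bit-even (suc s) rewrite *-suc 2 s = bit-even s

bit<2 : ∀ n → bit n < 2
bit<2 0             = s≤s z≤n
bit<2 1             = s≤s (s≤s z≤n)
bit<2 (suc (suc n)) = bit<2 n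

bit-step : ∀ n → FirstEdge (bit n) (bit (suc n))
bit-step 0             = inj₁ (refl , refl)
bit-step 1             = inj₂ (refl , refl)
bit-step (suc (suc n)) = bit-step n

module Winding (T s : ℕ) (2≤T : 2 ≤ T) where

  ℓ : ℕ
  ℓ = T + 2 * s

  -- Position k ≤ 2s zigzags along the first edge of the cycle (index bit k, offset k); position
  -- 2s + j follows the cycle at index j with offset 0. Offsets keep the zigzag positions distinct.
  index offset : ℕ → ℕ
  index k with k ≤? 2 * s
  ... | yes _ = bit k
  ... | no  _ = k ∸ 2 * s
  offset k with k ≤? 2 * s
  ... | yes _ = k
  ... | no  _ = 0

  zig-label : ∀ {k} → k ≤ 2 * s → index k ≡ bit k × offset k ≡ k
  zig-label {k} k≤ with k ≤? 2 * s
  ... | yes _ = refl , refl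
  ... | no k≰ = contradiction k≤ k≰

  tail-label : ∀ {k} → ¬ k ≤ 2 * s → index k ≡ k ∸ 2 * s × offset k ≡ 0
  tail-label {k} k≰ with k ≤? 2 * s
  ... | yes k≤ = contradiction k≤ k≰
  ... | no _ = refl , refl

  index-< : ∀ {k} → k < ℓ → index k < T
  index-< {k} k<ℓ with k ≤? 2 * s
  ... | yes _  = ≤-trans (bit<2 k) 2≤T
  ... | no k≰ = subst (k ∸ 2 * s <_) (m+n∸n≡m T (2 * s)) (∸-monoˡ-< k<ℓ (<⇒≤ (≰⇒> k≰)))

  offset-< : ∀ {k} → k < ℓ → offset k < ℓ
  offset-< {k} k<ℓ with k ≤? 2 * s
  ... | yes _ = k<ℓ
  ... | no  _ = ≤-trans (s≤s z≤n) (≤-trans 2≤T (m≤m+n T (2 * s)))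

  label-injective : ∀ {k k′} → index k ≡ index k′ → offset k ≡ offset k′ → k ≡ k′
  label-injective {k} {k′} same-index same-offset with k ≤? 2 * s | k′ ≤? 2 * s
  ... | yes _  | yes _   = same-offset
  ... | no k≰ | no k′≰ = ∸-cancelʳ-≡ (<⇒≤ (≰⇒> k≰)) (<⇒≤ (≰⇒> k′≰)) same-index
  ... | yes _  | no k′≰ rewrite same-offset = contradiction (sym same-index) (m>n⇒m∸n≢0 (≰⇒> k′≰))
  ... | no k≰ | yes _   rewrite sym same-offset = contradiction same-index (m>n⇒m∸n≢0 (≰⇒> k≰))

  tail-step : ∀ {k} → 2 * s < k → index (suc k) ≡ suc (index k) × offset (suc k) ≡ offset k
  tail-step {k} 2s<k with tail-label (<⇒≱ 2s<k) | tail-label (<⇒≱ (m<n⇒m<1+n 2s<k))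
  ... | index-k , offset-k | index-1+k , offset-1+k =
    trans index-1+k (trans (+-∸-assoc 1 (<⇒≤ 2s<k)) (cong suc (sym index-k))) , trans offset-1+k (sym offset-k)

  last-label : ∀ {k} → suc k ≡ ℓ → suc (index k) ≡ T × offset k ≡ 0
  last-label {k} 1+k≡ℓ = last-index , proj₂ (tail-label (<⇒≱ 2s<k))
    where
    2s<k : 2 * s < k
    2s<k = ≤-pred (subst (suc (suc (2 * s)) ≤_) (sym 1+k≡ℓ) (+-monoˡ-≤ (2 * s) 2≤T))
    last-index : suc (index k) ≡ T
    last-index = begin
      suc (index k)      ≡⟨ cong suc (proj₁ (tail-label (<⇒≱ 2s<k))) ⟩
      suc (k ∸ 2 * s)    ≡⟨ +-∸-assoc 1 (<⇒≤ 2s<k) ⟨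
      suc k ∸ 2 * s      ≡⟨ cong (_∸ 2 * s) 1+k≡ℓ ⟩
      ℓ ∸ 2 * s          ≡⟨ m+n∸n≡m T (2 * s) ⟩
      T                  ∎
      where open ≡-Reasoning

  label-step : ∀ k k′ → CycNextℕ ℓ k k′ →
    (CycNextℕ T (index k) (index k′) × offset k ≡ offset k′) ⊎ FirstEdge (index k) (index k′)
  label-step k _ (inj₁ refl) with <-cmp k (2 * s)
  ... | tri< k<2s _ _ =
    inj₂ (subst₂ FirstEdge (sym (proj₁ (zig-label (<⇒≤ k<2s)))) (sym (proj₁ (zig-label k<2s))) (bit-step k))
  ... | tri≈ _ refl _ =
    inj₂ (inj₁ (trans (proj₁ (zig-label ≤-refl)) (bit-even s) ,
                trans (proj₁ (tail-label (1+n≰n {2 * s}))) (m+n∸n≡m 1 (2 * s))))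
  ... | tri> _ _ 2s<k =
    let index-next , same-offset = tail-step 2s<k in inj₁ (inj₁ index-next , sym same-offset)
  label-step k _ (inj₂ (1+k≡ℓ , refl)) = let last , offset-k = last-label 1+k≡ℓ in
    inj₁ (inj₂ (last , proj₁ (zig-label z≤n)) , trans offset-k (sym (proj₂ (zig-label z≤n))))

  windIndex : Fin ℓ → Fin T
  windIndex k = fromℕ< (index-< (toℕ<n k))

  windOffset : Fin ℓ → Fin ℓ
  windOffset k = fromℕ< (offset-< (toℕ<n k))

  toℕ-windIndex : ∀ k → toℕ (windIndex k) ≡ index (toℕ k)
  toℕ-windIndex k = toℕ-fromℕ< (index-< (toℕ<n k))

  toℕ-windOffset : ∀ k → toℕ (windOffset k) ≡ offset (toℕ k)
  toℕ-windOffset k = toℕ-fromℕ< (offset-< (toℕ<n k))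

  wind-injective : ∀ {k k′} → windIndex k ≡ windIndex k′ → windOffset k ≡ windOffset k′ → k ≡ k′
  wind-injective {k} {k′} same-index same-offset = toℕ-injective (label-injective
    (trans (sym (toℕ-windIndex k)) (trans (cong toℕ same-index) (toℕ-windIndex k′)))
    (trans (sym (toℕ-windOffset k)) (trans (cong toℕ same-offset) (toℕ-windOffset k′))))

  wind-step : ∀ {k k′} → CycNext ℓ k k′ →
    (CycNext T (windIndex k) (windIndex k′) × windOffset k ≡ windOffset k′) ⊎
    FirstEdge (toℕ (windIndex k)) (toℕ (windIndex k′))
  wind-step {k} {k′} next with label-step (toℕ k) (toℕ k′) next
  ... | inj₁ (index-next , same-offset) =
    inj₁ (subst₂ (CycNextℕ T) (sym (toℕ-windIndex k)) (sym (toℕ-windIndex k′)) index-next ,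
          toℕ-injective (trans (toℕ-windOffset k) (trans same-offset (sym (toℕ-windOffset k′)))))
  ... | inj₂ first = inj₂ (subst₂ FirstEdge (sym (toℕ-windIndex k)) (sym (toℕ-windIndex k′)) first)

-- Parity

even-parity : ∀ n → parity n ≡ 0ℙ → ∃ λ q → n ≡ q * 2
even-parity 0             _    = 0 , refl
even-parity (suc (suc n)) even = let q , n≡ = even-parity n even in suc q , cong (2 +_) n≡

∤2⇒odd-parity : ∀ {n} → 2 ∤ n → parity n ≡ 1ℙ
∤2⇒odd-parity {n} 2∤n with parity n in p
... | 0ℙ = let q , n≡ = even-parity n p in contradiction (divides q n≡) 2∤n
... | 1ℙ = refl

same-parity⇒even-gap : ∀ {a b} → a ≤ b → parity a ≡ parity b → ∃ λ s → a + 2 * s ≡ b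
same-parity⇒even-gap {a} {b} a≤b same = s , trans (cong (a +_) (trans (*-comm 2 s) (sym gap≡))) (m+[n∸m]≡n a≤b)
  where
  gap-even : parity (b ∸ a) ≡ 0ℙ
  gap-even = +-cancelˡ-≡ (parity a) _ _
    (trans (sym (+-homo-+ a (b ∸ a)))
      (trans (cong parity (m+[n∸m]≡n a≤b)) (trans (sym same) (sym (⊕-identityʳ _)))))
  s : ℕ
  s = proj₁ (even-parity (b ∸ a) gap-even)
  gap≡ : b ∸ a ≡ s * 2
  gap≡ = proj₂ (even-parity (b ∸ a) gap-even)

-- Matched pairs of parts

matchedPair? : ∀ r x y → Dec (MatchedPair r x y)
matchedPair? r x y = ¬? (x ≟ℕ y) ×-dec (x <? 2 ^ r) ×-dec (y <? 2 ^ r) ×-dec (x / 2 ≟ℕ y / 2)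

matchedPair-sym : ∀ {r x y} → MatchedPair r x y → MatchedPair r y x
matchedPair-sym (x≢y , x< , y< , same) = x≢y ∘ sym , y< , x< , sym same

private
  distinct-bits : ∀ {a b c} → a < 2 → b < 2 → c < 2 → a ≢ b → b ≢ c → a ≡ c
  distinct-bits {0} {0}         _ _ _ a≢b _   = contradiction refl a≢b
  distinct-bits {0} {1} {0}     _ _ _ _   _   = refl
  distinct-bits {0} {1} {1}     _ _ _ _   b≢c = contradiction refl b≢c
  distinct-bits {1} {0} {0}     _ _ _ _   b≢c = contradiction refl b≢c
  distinct-bits {1} {0} {1}     _ _ _ _   _   = refl
  distinct-bits {1} {1}         _ _ _ a≢b _   = contradiction refl a≢b
  distinct-bits {suc (suc _)} (s≤s (s≤s ())) _ _ _ _
  distinct-bits {b = suc (suc _)} _ (s≤s (s≤s ())) _ _ _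
  distinct-bits {0} {1} {suc (suc _)} _ _ (s≤s (s≤s ())) _ _
  distinct-bits {1} {0} {suc (suc _)} _ _ (s≤s (s≤s ())) _ _

  same-half-and-bit : ∀ {x y} → x / 2 ≡ y / 2 → x % 2 ≡ y % 2 → x ≡ y
  same-half-and-bit {x} {y} half bit =
    trans (m≡m%n+[m/n]*n x 2) (trans (cong₂ (λ b h → b + h * 2) bit half) (sym (m≡m%n+[m/n]*n y 2)))

matchedPair-partner : ∀ {r x y z} → MatchedPair r x y → MatchedPair r y z → x ≡ z
matchedPair-partner {x = x} {y} {z} (x≢y , _ , _ , xy) (y≢z , _ , _ , yz) =
  same-half-and-bit (trans xy yz)
    (distinct-bits (m%n<n x 2) (m%n<n y 2) (m%n<n z 2)
      (x≢y ∘ same-half-and-bit xy) (y≢z ∘ same-half-and-bit yz))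

private
  top-part : ∀ {r′ z} → z < 2 ^ suc r′ + 1 → ¬ z < 2 ^ suc r′ → z ≡ 2 ^ suc r′
  top-part {r′} {z} z< z≮ = ≤-antisym (≤-pred (subst (z <_) (+-comm (2 ^ suc r′) 1) z<)) (≮⇒≥ z≮)

  half-top-part : ∀ {r′ z} → z < 2 ^ suc r′ + 1 → ¬ z < 2 ^ suc r′ → z / 2 ≡ 2 ^ r′
  half-top-part {r′} z<N z≮ =
    trans (cong (_/ 2) (trans (top-part {r′} z<N z≮) (*-comm 2 (2 ^ r′)))) (m*n/n≡m (2 ^ r′) 2)

  half-below : ∀ {r′ y} → y < 2 ^ suc r′ → y / 2 < 2 ^ r′
  half-below {r′} {y} y< = m<n*o⇒m/o<n (subst (y <_) (*-comm 2 (2 ^ r′)) y<)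

sameHalf⇒matched : ∀ {r′ x y} → x ≢ y → x < 2 ^ suc r′ + 1 → y < 2 ^ suc r′ + 1 → x / 2 ≡ y / 2 →
  MatchedPair (suc r′) x y
sameHalf⇒matched {r′} {x} {y} x≢y x<N y<N same with x <? 2 ^ suc r′ | y <? 2 ^ suc r′
... | yes x< | yes y< = x≢y , x< , y< , same
... | no x≮  | yes y< = contradiction (trans (sym same) (half-top-part {r′} x<N x≮)) (<⇒≢ (half-below {r′} y<))
... | yes x< | no y≮  = contradiction (trans same (half-top-part {r′} y<N y≮)) (<⇒≢ (half-below {r′} x<))
... | no x≮  | no y≮  = contradiction (trans (top-part {r′} x<N x≮) (sym (top-part {r′} y<N y≮))) x≢y

-- Lifting cycles of the reduced colouring to H

module Blowup {m r′ ℓ′ : ℕ} (κ : Colouring (H m (suc r′)) (suc r′)) where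

  r N ℓ : ℕ
  r = suc r′
  N = 2 ^ r + 1
  ℓ = suc ℓ′

  Vertex : Set
  Vertex = Fin N × Fin m

  part : Vertex → ℕ
  part = toℕ ∘ proj₁

  adjacent? : ∀ u v → Dec (HAdj m r u v)
  adjacent? (i , a) (j , b) = ¬? (toℕ i ≟ℕ toℕ j) ×-dec (matchedPair? r (toℕ i) (toℕ j) →-dec (a ≟ b))

  orientedColour : Vertex → Vertex → Fin r
  orientedColour u v with adjacent? u v
  ... | yes e = col κ u v e
  ... | no  _ = zero

  orientedColour-spec : ∀ {u v} → HAdj m r u v → Σ (HAdj m r u v) λ e → col κ u v e ≡ orientedColour u v
  orientedColour-spec {u} {v} e with adjacent? u v
  ... | yes e′ = e′ , refl
  ... | no ¬e = contradiction e ¬e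

  -- A colouring may depend on the adjacency proof, so a symmetric colour function has to pick one
  -- orientation of every pair of parts.
  colourOf : Vertex → Vertex → Fin r
  colourOf u v with part u <? part v
  ... | yes _ = orientedColour u v
  ... | no  _ = orientedColour v u

  colourOf-< : ∀ {u v} → part u < part v → colourOf u v ≡ orientedColour u v
  colourOf-< {u} {v} u<v with part u <? part v
  ... | yes _ = refl
  ... | no u≮v = contradiction u<v u≮v

  colourOf-> : ∀ {u v} → part v < part u → colourOf u v ≡ orientedColour v u
  colourOf-> {u} {v} v<u with part u <? part v
  ... | yes u<v = contradiction u<v (<⇒≯ v<u)
  ... | no _ = refl

  colourOf-sym : ∀ {u v} → part u ≢ part v → colourOf u v ≡ colourOf v u
  colourOf-sym {u} {v} u≢v with <-cmp (part u) (part v)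
  ... | tri< u<v _ _ = trans (colourOf-< u<v) (sym (colourOf-> u<v))
  ... | tri≈ _ u≡v _ = contradiction u≡v u≢v
  ... | tri> _ _ v<u = trans (colourOf-> v<u) (sym (colourOf-< v<u))

  colourOf-spec : ∀ {u v} → HAdj m r u v → Σ (HAdj m r u v) λ e → col κ u v e ≡ colourOf u v
  colourOf-spec {u} {v} e with <-cmp (part u) (part v)
  ... | tri< u<v _ _ = let e′ , c = orientedColour-spec e in e′ , trans c (sym (colourOf-< u<v))
  ... | tri≈ _ u≡v _ = contradiction u≡v (proj₁ e)
  ... | tri> _ _ v<u = let e′ , c = orientedColour-spec (HAdj-sym r e) in
                       HAdj-sym r e′ , trans (col-sym κ e′) (trans c (sym (colourOf-> v<u)))

  pairColour : Fin m → Fin m → Fin N × Fin N → Fin r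
  pairColour a b (i , j) = colourOf (i , a) (j , b)

  pairs : List (Fin N × Fin N)
  pairs = cartesianProduct (allFin N) (allFin N)

  ∈-pairs : ∀ p → p ∈ pairs
  ∈-pairs (i , j) = ∈-cartesianProduct⁺ (∈-allFin i) (∈-allFin j)

  module Lift (cs : CanonicalSequence pairColour pairs ∈-pairs (N * ℓ)) where

    open CanonicalSequence cs

    Matched : Fin N → Fin N → Set
    Matched x y = MatchedPair r (toℕ x) (toℕ y)

    matched? : ∀ x y → Dec (Matched x y)
    matched? x y = matchedPair? r (toℕ x) (toℕ y)

    matched-partner : ∀ {x y z} → Matched x y → Matched y z → x ≡ z
    matched-partner M₁ M₂ = toℕ-injective (matchedPair-partner {r} M₁ M₂)

    block : Fin N → Fin N
    block x = fromℕ< (≤-<-trans (m/n≤m (toℕ x) 2) (toℕ<n x))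

    toℕ-block : ∀ x → toℕ (block x) ≡ toℕ x / 2
    toℕ-block x = toℕ-fromℕ< (≤-<-trans (m/n≤m (toℕ x) 2) (toℕ<n x))

    -- Parts 2i and 2i + 1 share block i, so a matched pair of parts can use the same index.
    slot : Fin N → Fin ℓ → Fin (N * ℓ)
    slot x o = combine (block x) o

    ⟨_,_⟩ : Fin N → Fin ℓ → Vertex
    ⟨ x , o ⟩ = x , seq (slot x o)

    ⟨⟩-injective : ∀ {x y o o′} → ⟨ x , o ⟩ ≡ ⟨ y , o′ ⟩ → x ≡ y × o ≡ o′
    ⟨⟩-injective {x} {y} {o} {o′} eq =
      cong proj₁ eq , combine-injectiveʳ (block x) o (block y) o′ (seq-injective (cong proj₂ eq))

    matched-slot : ∀ {x y} → Matched x y → ∀ o → slot x o ≡ slot y o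
    matched-slot {x} {y} (_ , _ , _ , same) o =
      cong (λ b → combine {n = ℓ} b o) (toℕ-injective (trans (toℕ-block x) (trans same (sym (toℕ-block y)))))

    unmatched-slot-< : ∀ {x y} → toℕ x < toℕ y → ¬ Matched x y → ∀ o o′ → toℕ (slot x o) < toℕ (slot y o′)
    unmatched-slot-< {x} {y} x<y ¬M o o′ =
      combine-monoˡ-< o o′ (subst₂ _<_ (sym (toℕ-block x)) (sym (toℕ-block y))
        (≤∧≢⇒< (/-monoˡ-≤ 2 (<⇒≤ x<y)) (¬M ∘ sameHalf⇒matched {r′} (<⇒≢ x<y) (toℕ<n x) (toℕ<n y))))

    matched-colour : ∀ {x y} → Matched x y → ∀ o → colourOf ⟨ x , o ⟩ ⟨ y , o ⟩ ≡ diagonal (x , y)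
    matched-colour {x} {y} M o =
      trans (cong (λ t → colourOf ⟨ x , o ⟩ (y , seq t)) (sym (matched-slot M o))) (colour-≡ (slot x o) (x , y))

    unmatched-colour : ∀ {x y} → toℕ x < toℕ y → ¬ Matched x y → ∀ o o′ →
      colourOf ⟨ x , o ⟩ ⟨ y , o′ ⟩ ≡ offDiagonal (x , y)
    unmatched-colour x<y ¬M o o′ = colour-< (unmatched-slot-< x<y ¬M o o′) _

    colourOf-⟨⟩-independent : ∀ {x y o₁ o₁′ o₂ o₂′} → x ≢ y →
      (Matched x y → o₁ ≡ o₁′) → (Matched x y → o₂ ≡ o₂′) →
      colourOf ⟨ x , o₁ ⟩ ⟨ y , o₁′ ⟩ ≡ colourOf ⟨ x , o₂ ⟩ ⟨ y , o₂′ ⟩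
    colourOf-⟨⟩-independent {x} {y} {o₁} {o₁′} {o₂} {o₂′} x≢y same₁ same₂ with matchedPair? r (toℕ x) (toℕ y)
    ... | yes M rewrite same₁ M | same₂ M = trans (matched-colour M o₁′) (sym (matched-colour M o₂′))
    ... | no ¬M with <-cmp (toℕ x) (toℕ y)
    ...   | tri< x<y _ _ = trans (unmatched-colour x<y ¬M o₁ o₁′) (sym (unmatched-colour x<y ¬M o₂ o₂′))
    ...   | tri≈ _ x≡y _ = contradiction (toℕ-injective x≡y) x≢y
    ...   | tri> _ _ y<x = begin
      colourOf ⟨ x , o₁ ⟩ ⟨ y , o₁′ ⟩  ≡⟨ colourOf-sym (<⇒≢ y<x ∘ sym) ⟩
      colourOf ⟨ y , o₁′ ⟩ ⟨ x , o₁ ⟩  ≡⟨ unmatched-colour y<x (¬M ∘ matchedPair-sym {r}) o₁′ o₁ ⟩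
      offDiagonal (y , x)              ≡⟨ sym (unmatched-colour y<x (¬M ∘ matchedPair-sym {r}) o₂′ o₂) ⟩
      colourOf ⟨ y , o₂′ ⟩ ⟨ x , o₂ ⟩  ≡⟨ colourOf-sym (<⇒≢ y<x) ⟩
      colourOf ⟨ x , o₂ ⟩ ⟨ y , o₂′ ⟩  ∎
      where open ≡-Reasoning

    ρ : Fin N → Fin N → Fin r
    ρ x y = colourOf ⟨ x , zero ⟩ ⟨ y , zero ⟩

    ρ-sym : ∀ {x y} → x ≢ y → ρ x y ≡ ρ y x
    ρ-sym x≢y = colourOf-sym (x≢y ∘ toℕ-injective)

    lift-edge : ∀ {x y o o′} → x ≢ y → (Matched x y → o ≡ o′) →
      Σ (HAdj m r ⟨ x , o ⟩ ⟨ y , o′ ⟩) λ e → col κ _ _ e ≡ ρ x y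
    lift-edge {x} {y} {o} {o′} x≢y same =
      let e , c = colourOf-spec adjacent in e , trans c (colourOf-⟨⟩-independent x≢y same (λ _ → refl))
      where
      adjacent : HAdj m r ⟨ x , o ⟩ ⟨ y , o′ ⟩
      adjacent = x≢y ∘ toℕ-injective , λ M → cong seq (trans (matched-slot M o) (cong (slot y) (same M)))

    liftCycle : ∀ {c} (C : OddCycle (HasColour ρ (toℕ c)) Matched) s →
      OddCycle.cycleLength C + 2 * s ≡ ℓ → MonoCycle (H m r) κ ℓ
    liftCycle {c} C s length≡ = subst (MonoCycle (H m r) κ) length≡ (c , vertex , injective , edge)
      where
      open OddCycle C renaming (vertex to p; injective to p-injective; edge to p-edge)
      open Winding cycleLength s (≤-trans (s≤s (s≤s z≤n)) nontrivial)

      vertex : Fin (cycleLength + 2 * s) → Vertex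
      vertex k = ⟨ p (windIndex k) , cast length≡ (windOffset k) ⟩

      injective : Injective _≡_ _≡_ vertex
      injective same = let same-part , same-offset = ⟨⟩-injective same in
        wind-injective (p-injective same-part)
          (toℕ-injective (trans (sym (toℕ-cast length≡ _)) (trans (cong toℕ same-offset) (toℕ-cast length≡ _))))

      lifted : ∀ {a a′ o o′} → HasColour ρ (toℕ c) (p a) (p a′) → (Matched (p a) (p a′) → o ≡ o′) →
        Σ (HAdj m r ⟨ p a , o ⟩ ⟨ p a′ , o′ ⟩) λ e → col κ _ _ e ≡ c
      lifted (different , colour) same = let e , colour≡ρ = lift-edge different same in
        e , trans colour≡ρ (toℕ-injective colour)

      edge : ∀ k k′ → CycNext (cycleLength + 2 * s) k k′ →
        Σ (HAdj m r (vertex k) (vertex k′)) λ e → col κ _ _ e ≡ c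
      edge k k′ next with wind-step next
      ... | inj₁ (index-next , same-offset) =
        lifted (p-edge _ _ index-next) (λ _ → cong (cast length≡) same-offset)
      ... | inj₂ (inj₁ (a≡0 , a′≡1)) =
        lifted (p-edge _ _ (inj₁ (trans a′≡1 (cong suc (sym a≡0)))))
               (λ M → contradiction M (start-unmatched _ _ a≡0 a′≡1))
      ... | inj₂ (inj₂ (a≡1 , a′≡0)) =
        lifted (HasColour-sym ρ ρ-sym (p-edge _ _ (inj₁ (trans a≡1 (cong suc (sym a′≡0))))))
               (λ M → contradiction (matchedPair-sym {r} M) (start-unmatched _ _ a′≡0 a≡1))

    monochromaticCycle : N ≤ ℓ → 2 ∤ ℓ → MonoCycle (H m r) κ ℓ
    monochromaticCycle N≤ℓ 2∤ℓ
      with monochromaticOddCycle ρ ρ-sym matched? matched-partner (≤-reflexive (+-comm 1 (2 ^ r)))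
    ... | c , C with same-parity⇒even-gap (≤-trans (injective⇒≤ (OddCycle.injective C)) N≤ℓ)
                                          (trans (OddCycle.odd C) (sym (∤2⇒odd-parity 2∤ℓ)))
    ... | s , length≡ = liftCycle C s length≡

threshold : ℕ → ℕ → ℕ
threshold r ℓ = canonicalBound (r ^ length (cartesianProduct (allFin N) (allFin N))) (N * ℓ)
  where N = 2 ^ r + 1

lemma3p6 : (r ℓ : ℕ) → r ≥ 3 → ℓ ≥ 2 ^ r + 1 → 2 ∤ ℓ →
    Σ ℕ λ m₀ → (m : ℕ) → m ≥ m₀ → CycleRamsey (H m r) ℓ r
lemma3p6 (suc r′) (suc ℓ′) _ N≤ℓ 2∤ℓ = threshold (suc r′) (suc ℓ′) , λ m m≥m₀ κ →
  Blowup.Lift.monochromaticCycle {ℓ′ = ℓ′} κ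
    (canonicalSequence _ _ _ _ (allFin m) (allFin⁺ m)
      (subst (threshold (suc r′) (suc ℓ′) ≤_) (sym (length-tabulate (λ x → x))) m≥m₀))
    N≤ℓ 2∤ℓ
lemma3p6 (suc r′) zero _ N≤ℓ _ = contradiction (≤-trans (m≤n+m 1 (2 ^ suc r′)) N≤ℓ) λ ()
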